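{- For every $n\in\mathbb N$ the set $W(n,n-1)$ contains exactly one element, namely the partition of $\{1,\dots,n\}$ whose blocks are $\{i,n+1-i\}$ for $1\le i\le\lceil n/2\rceil$ (for odd $n$ the block for $i=\lceil n/2\rceil$ is the singleton $\{(n+1)/2\}$).
   Context: For $n\in\mathbb N$ let $\mathcal{NC}(0,n)$ be the set of non-crossing partitions of $\{1,\dots,n\}$. For $0\le r<n$ write $s=\lfloor r/2\rfloor$ and define $W(n,r)\subseteq\mathcal{NC}(0,n)$: if $r=2s$, $W(n,r)$ consists of the partitions in which none of the points $1,\dots,s$ is a singleton and the points $1,\dots,s+1$ lie in pairwise different blocks; if $r=2s+1$, $W(n,r)$ consists of the partitions in which none of the points $1,\dots,s+1$ is a singleton and these points lie in pairwise different blocks. -}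

module Defs where

open import Data.Nat using (ℕ; zero; suc; _+_; _<_; _/_; _%_)
open import Data.Nat using (_≡ᵇ_)
open import Data.Bool using (Bool; true; false; _∨_)
open import Data.Fin using (Fin; toℕ)
open import Relation.Binary.PropositionalEquality using (_≡_; _≢_)
open import Relation.Nullary using (¬_)
open import Data.Product using (_×_)

-- Points {1,…,n} are represented 0-indexed by Fin n (point k+1 ↔ toℕ = k).
-- A set partition of {1,…,n} is represented by its "same block" relation,
-- a Boolean-valued equivalence relation on Fin n.
record Partition (n : ℕ) : Set where
  field
    rel     : Fin n → Fin n → Bool
    rel-refl  : ∀ i → rel i i ≡ true
    rel-sym   : ∀ i j → rel i j ≡ true → rel j i ≡ true
    rel-trans : ∀ i j k → rel i j ≡ true → rel j k ≡ true → rel i k ≡ true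
open Partition public

NonCrossing : ∀ {n} → Partition n → Set
NonCrossing {n} P =
  ∀ (a b c d : Fin n) → toℕ a < toℕ b → toℕ b < toℕ c → toℕ c < toℕ d →
  rel P a c ≡ true → rel P b d ≡ true → rel P a b ≡ true

record NCPartition (n : ℕ) : Set where
  field
    part : Partition n
    nonCrossing : NonCrossing part
open NCPartition public

IsSingleton : ∀ {n} → Partition n → Fin n → Set
IsSingleton P i = ∀ j → rel P i j ≡ true → j ≡ i

NoSingletonAmongFirst : ∀ {n} → ℕ → Partition n → Set
NoSingletonAmongFirst k P = ∀ i → toℕ i < k → ¬ IsSingleton P i

DistinctBlocksFirst : ∀ {n} → ℕ → Partition n → Set
DistinctBlocksFirst k P =
  ∀ i j → toℕ i < k → toℕ j < k → i ≢ j → rel P i j ≡ false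

InW : (n r : ℕ) → NCPartition n → Set
InW n r π with r % 2
... | 0 = NoSingletonAmongFirst (r / 2) (part π)
        × DistinctBlocksFirst (suc (r / 2)) (part π)
... | _ = NoSingletonAmongFirst (suc (r / 2)) (part π)
        × DistinctBlocksFirst (suc (r / 2)) (part π)

-- The partition with blocks {i, n+1-i} of {1,…,n} (1-indexed), i.e.
-- 0-indexed: i ~ j iff i = j or i + j = n - 1.
mirrorRel : (n : ℕ) → Fin n → Fin n → Bool
mirrorRel n i j = (toℕ i ≡ᵇ toℕ j) ∨ (suc (toℕ i + toℕ j) ≡ᵇ n)

module Submission where

-- Write s = ⌊m/2⌋, K = ⌈m/2⌉, so
-- s + K = m and W(m+1, m) asks that the first K points are not singletons and
-- the first s+1 points lie in different blocks.
--
-- Let π be such a non-crossing partition.  Each point i < K has a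
-- partner p(i) ≠ i in its block; p(i) > s since the first s+1 blocks are
-- distinct, and p(0) > p(1) > … > p(K-1) since π is non-crossing.  A strictly
-- decreasing chain of K numbers squeezed into the K-element interval (s, m]
-- is forced: p(i) = m - i (lemma SqueezedChain.forced).  Hence i ~ m-i for
-- i < K, so folding x ↦ min(x, m-x) maps every point into its own block and
-- onto the first s+1 points, which lie in pairwise different blocks.  Such a
-- "transversal map" determines a partition (rel-via-transversal); the mirror
-- partition has the same transversal map, so π is the mirror partition.
-- Existence.  The mirror partition is non-crossing and satisfies both
-- conditions by direct arithmetic.

open import Defs
open import Data.Nat using (ℕ; zero; suc; _+_; _*_; _∸_; _≤_; _<_; _≤?_; _<?_; _/_; _%_; s≤s; s≤s⁻¹)
open import Data.Nat.Properties
open import Data.Nat.DivMod using (m≡m%n+[m/n]*n; m%n<n)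
open import Data.Nat.Tactic.RingSolver using (solve-∀)
open import Data.Bool using (true)
import Data.Bool.Properties as Bool
open import Data.Fin using (Fin; toℕ; fromℕ<; opposite)
import Data.Fin.Properties as Fin
open import Data.Product using (Σ; ∃; ∃-syntax; _×_; _,_; proj₂)
open import Data.Sum using (_⊎_; inj₁; inj₂)
import Data.Sum as Sum
open import Data.Empty using (⊥-elim)
open import Function using (id; _∘_)
open import Function.Bundles using (_⇔_; mk⇔; Equivalence)
open import Relation.Nullary using (¬_; yes; no)
open import Relation.Nullary.Decidable using (isYes; ¬?; _×-dec_; decidable-stable)
open import Relation.Binary.PropositionalEquality

open Equivalence using (to; from)

distinct-blocks⇒equal : ∀ {n k} (P : Partition n) → DistinctBlocksFirst k P →
  ∀ {i j} → toℕ i < k → toℕ j < k → rel P i j ≡ true → i ≡ j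
distinct-blocks⇒equal P distinct {i} {j} i<k j<k i~j =
  decidable-stable (i Fin.≟ j) λ i≢j → Bool.not-¬ i~j (distinct i j i<k j<k i≢j)

partner : ∀ {n} (P : Partition n) a → ¬ IsSingleton P a → ∃[ b ] b ≢ a × rel P a b ≡ true
partner P a non-singleton
  with Fin.any? (λ b → ¬? (b Fin.≟ a) ×-dec (rel P a b Bool.≟ true))
... | yes found = found
... | no none = ⊥-elim (non-singleton λ b a~b →
        decidable-stable (b Fin.≟ a) λ b≢a → none (b , b≢a , a~b))

record Transversal {n} (P : Partition n) (r : Fin n → Fin n) : Set where
  field
    joins     : ∀ x → rel P x (r x) ≡ true
    separates : ∀ x y → rel P (r x) (r y) ≡ true → r x ≡ r y

rel-via-transversal : ∀ {n} {P : Partition n} {r : Fin n → Fin n} → Transversal P r →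
  ∀ a b → rel P a b ≡ isYes (r a Fin.≟ r b)
rel-via-transversal {P = P} {r} t a b with r a Fin.≟ r b
... | yes ra≡rb = rel-trans P a (r a) b (joins a) (subst (λ c → rel P c b ≡ true) (sym ra≡rb) (rel-sym P b (r b) (joins b)))
  where open Transversal t
... | no ra≢rb = Bool.¬-not λ a~b → ra≢rb (separates a b
        (rel-trans P (r a) a (r b) (rel-sym P a (r a) (joins a)) (rel-trans P a b (r b) a~b (joins b))))
  where open Transversal t

same-transversal⇒same-blocks : ∀ {n} {P Q : Partition n} {r : Fin n → Fin n} →
  Transversal P r → Transversal Q r → ∀ a b → rel P a b ≡ rel Q a b
same-transversal⇒same-blocks tP tQ a b = trans (rel-via-transversal tP a b) (sym (rel-via-transversal tQ a b))

module SqueezedChain {s K m : ℕ} (s+K≡m : s + K ≡ m) (_⟶_ : ℕ → ℕ → Set)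
  (has-partner : ∀ {i} → i < K → ∃ (i ⟶_))
  (bounded : ∀ {i j} → i ⟶ j → j ≤ m)
  (above : ∀ {i j} → i < K → i ⟶ j → s < j)
  (decreasing : ∀ {i j j′} → suc i < K → i ⟶ j → suc i ⟶ j′ → j′ < j) where

  open ≤-Reasoning

  -- by induction upwards from 0: the values start at most at m and decrease
  at-most : ∀ i {j} → i < K → i ⟶ j → j + i ≤ m
  at-most zero {j} _ 0⟶j = subst (_≤ m) (sym (+-identityʳ j)) (bounded 0⟶j)
  at-most (suc i) {j} 1+i<K 1+i⟶j with has-partner (≤-trans (n≤1+n _) 1+i<K)
  ... | j₀ , i⟶j₀ = begin
    j + suc i  ≡⟨ +-suc j i ⟩
    suc j + i  ≤⟨ +-monoˡ-≤ i (decreasing 1+i<K i⟶j₀ 1+i⟶j) ⟩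
    j₀ + i     ≤⟨ at-most i (≤-trans (n≤1+n _) 1+i<K) i⟶j₀ ⟩
    m          ∎

  -- by induction downwards from K-1 = i + d: the values end above s and decrease
  at-least : ∀ d i {j} → suc d + i ≡ K → i ⟶ j → m ≤ j + i
  at-least zero i {j} 1+i≡K i⟶j = begin
    m          ≡⟨ sym s+K≡m ⟩
    s + K      ≡⟨ cong (s +_) (sym 1+i≡K) ⟩
    s + suc i  ≡⟨ +-suc s i ⟩
    suc s + i  ≤⟨ +-monoˡ-≤ i (above (subst (i <_) 1+i≡K ≤-refl) i⟶j) ⟩
    j + i      ∎
  at-least (suc d) i {j} e i⟶j with has-partner (subst (suc i <_) e (s≤s (s≤s (m≤n+m i d))))
  ... | j₁ , 1+i⟶j₁ = begin
    m            ≤⟨ at-least d (suc i) (trans (cong suc (+-suc d i)) e) 1+i⟶j₁ ⟩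
    j₁ + suc i   ≡⟨ +-suc j₁ i ⟩
    suc j₁ + i   ≤⟨ +-monoˡ-≤ i (decreasing (subst (suc i <_) e (s≤s (s≤s (m≤n+m i d)))) i⟶j 1+i⟶j₁) ⟩
    j + i        ∎

  forced : ∀ {i j} → i < K → i ⟶ j → j + i ≡ m
  forced {i} i<K i⟶j = ≤-antisym (at-most i i<K i⟶j)
    (at-least (K ∸ suc i) i (trans (sym (+-suc (K ∸ suc i) i)) (m∸n+n≡m i<K)) i⟶j)

Shaped : ∀ {n} → ℕ → ℕ → Partition n → Set
Shaped s K P = NoSingletonAmongFirst K P × DistinctBlocksFirst (suc s) P

record Halves (m s K : ℕ) : Set where
  field
    s+K≡m : s + K ≡ m
    s≤K   : s ≤ K
    K≤1+s : K ≤ suc s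

-- ⌈m/2⌉ = (m mod 2) + ⌊m/2⌋, and m = (m mod 2) + 2⌊m/2⌋
halves : ∀ m → Halves m (m / 2) (m % 2 + m / 2)
halves m = record
  { s+K≡m = trans (halves-identity (m / 2) (m % 2)) (sym (m≡m%n+[m/n]*n m 2))
  ; s≤K   = m≤n+m (m / 2) (m % 2)
  ; K≤1+s = +-monoˡ-≤ (m / 2) (s≤s⁻¹ (m%n<n m 2))
  }
  where
  halves-identity : ∀ q r → q + (r + q) ≡ r + q * 2
  halves-identity = solve-∀

InW⇔Shaped : ∀ m (π : NCPartition (suc m)) → InW (suc m) m π ⇔ Shaped (m / 2) (m % 2 + m / 2) (part π)
InW⇔Shaped m π with m % 2 | m%n<n m 2
... | 0 | _ = mk⇔ id id
... | 1 | _ = mk⇔ id id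
... | suc (suc _) | s≤s (s≤s ())

module WPartitions {m s K : ℕ} (halves : Halves m s K) where
  open Halves halves

  Point : Set
  Point = Fin (suc m)

  K≤m : K ≤ m
  K≤m = subst (K ≤_) s+K≡m (m≤n+m K s)

  toℕ≤m : ∀ (x : Point) → toℕ x ≤ m
  toℕ≤m x = s≤s⁻¹ (Fin.toℕ<n x)

  toℕ-opposite : ∀ (x : Point) → toℕ (opposite x) ≡ m ∸ toℕ x
  toℕ-opposite = Fin.opposite-prop

  mirror-of-large : ∀ {x : Point} → s < toℕ x → toℕ (opposite x) < K
  mirror-of-large {x} s<x = subst₂ _<_ (sym (toℕ-opposite x)) m∸s≡K (∸-monoʳ-< s<x (toℕ≤m x))
    where m∸s≡K : m ∸ s ≡ K
          m∸s≡K = trans (cong (_∸ s) (sym s+K≡m)) (m+n∸m≡n s K)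

  Paired : Partition (suc m) → Set
  Paired P = ∀ i → toℕ i < K → rel P i (opposite i) ≡ true

  -- The partners of the first K points of a shaped non-crossing partition form a
  -- squeezed chain; hence the partner of i is its mirror image.
  module PartnerChain (π : NCPartition (suc m)) (non-singleton : NoSingletonAmongFirst K (part π))
                      (distinct : DistinctBlocksFirst (suc s) (part π)) where
    P : Partition (suc m)
    P = part π

    _⟶_ : ℕ → ℕ → Set
    x ⟶ y = Σ Point λ a → Σ Point λ b → toℕ a ≡ x × toℕ b ≡ y × b ≢ a × rel P a b ≡ true

    has-partner : ∀ {x} → x < K → ∃ (x ⟶_)
    has-partner {x} x<K = link (partner P a (non-singleton a (subst (_< K) (sym toℕa≡x) x<K)))
      where
        x<1+m : x < suc m
        x<1+m = ≤-trans x<K (≤-trans K≤m (n≤1+n m))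
        a : Point
        a = fromℕ< x<1+m
        toℕa≡x : toℕ a ≡ x
        toℕa≡x = Fin.toℕ-fromℕ< x<1+m
        link : ∃[ b ] b ≢ a × rel P a b ≡ true → ∃ (x ⟶_)
        link (b , b≢a , a~b) = toℕ b , a , b , toℕa≡x , refl , b≢a , a~b

    bounded : ∀ {x y} → x ⟶ y → y ≤ m
    bounded (_ , b , _ , refl , _) = toℕ≤m b

    -- partners of the first K points lie beyond s, as the first s+1 blocks are distinct
    above : ∀ {x y} → x < K → x ⟶ y → s < y
    above x<K (a , b , refl , refl , b≢a , a~b) with s <? toℕ b
    ... | yes s<b = s<b
    ... | no s≮b = ⊥-elim (b≢a (sym (distinct-blocks⇒equal P distinct
            (≤-trans x<K K≤1+s) (s≤s (≮⇒≥ s≮b)) a~b)))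

    -- consecutive first points a, a′ whose partners satisfy b ≤ b′ share a block:
    -- either b = b′, or a < a′ < b < b′ is a crossing
    nested : ∀ {a a′ b b′ : Point} → toℕ a′ ≡ suc (toℕ a) → toℕ a′ < K →
      rel P a b ≡ true → rel P a′ b′ ≡ true → s < toℕ b → toℕ b ≤ toℕ b′ → rel P a a′ ≡ true
    nested {a} {a′} {b} {b′} a′≡1+a a′<K a~b a′~b′ s<b b≤b′ with m≤n⇒m<n∨m≡n b≤b′
    ... | inj₁ b<b′ = nonCrossing π a a′ b b′ (subst (toℕ a <_) (sym a′≡1+a) ≤-refl)
            (≤-<-trans (s≤s⁻¹ (≤-trans a′<K K≤1+s)) s<b) b<b′ a~b a′~b′
    ... | inj₂ b≡b′ = rel-trans P a b a′ a~b
            (rel-sym P a′ b (subst (λ c → rel P a′ c ≡ true) (sym (Fin.toℕ-injective b≡b′)) a′~b′))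

    -- partners of consecutive first points decrease, else those points would share a block
    decreasing : ∀ {x y y′} → suc x < K → x ⟶ y → suc x ⟶ y′ → y′ < y
    decreasing 1+x<K x⟶y@(a , b , refl , refl , _ , a~b) (a′ , b′ , a′≡1+a , refl , _ , a′~b′)
      with toℕ b′ <? toℕ b
    ... | yes b′<b = b′<b
    ... | no b′≮b = ⊥-elim (<⇒≢ (n<1+n (toℕ a)) (trans (cong toℕ a≡a′) a′≡1+a))
      where
        a′<K : toℕ a′ < K
        a′<K = subst (_< K) (sym a′≡1+a) 1+x<K
        a≡a′ : a ≡ a′
        a≡a′ = distinct-blocks⇒equal P distinct (≤-trans (≤-trans (n≤1+n _) 1+x<K) K≤1+s)
                 (≤-trans a′<K K≤1+s)
                 (nested a′≡1+a a′<K a~b a′~b′ (above (≤-trans (n≤1+n _) 1+x<K) x⟶y) (≮⇒≥ b′≮b))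

    open SqueezedChain s+K≡m _⟶_ has-partner bounded above decreasing using (forced)

    partner-is-opposite : ∀ {i b} → toℕ i < K → b ≢ i → rel P i b ≡ true → b ≡ opposite i
    partner-is-opposite {i} {b} i<K b≢i i~b = Fin.toℕ-injective (begin
      toℕ b                   ≡⟨ sym (m+n∸n≡m (toℕ b) (toℕ i)) ⟩
      toℕ b + toℕ i ∸ toℕ i   ≡⟨ cong (_∸ toℕ i) (forced i<K (i , b , refl , refl , b≢i , i~b)) ⟩
      m ∸ toℕ i               ≡⟨ sym (toℕ-opposite i) ⟩
      toℕ (opposite i)        ∎)
      where open ≡-Reasoning

  paired : (π : NCPartition (suc m)) → Shaped s K (part π) → Paired (part π)
  paired π (non-singleton , distinct) i i<K with partner (part π) i (non-singleton i i<K)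
  ... | b , b≢i , i~b = subst (λ c → rel (part π) i c ≡ true) (partner-is-opposite i<K b≢i i~b) i~b
    where open PartnerChain π non-singleton distinct

  fold : Point → Point
  fold x with toℕ x ≤? s
  ... | yes _ = x
  ... | no _ = opposite x

  fold-small : ∀ x → toℕ (fold x) < suc s
  fold-small x with toℕ x ≤? s
  ... | yes x≤s = s≤s x≤s
  ... | no x≰s = ≤-trans (mirror-of-large (≰⇒> x≰s)) K≤1+s

  fold-transversal : (P : Partition (suc m)) → DistinctBlocksFirst (suc s) P → Paired P → Transversal P fold
  fold-transversal P distinct pairs = record { joins = joins ; separates = separates }
    where
      joins : ∀ x → rel P x (fold x) ≡ true
      joins x with toℕ x ≤? s
      ... | yes _ = rel-refl P x
      ... | no x≰s = rel-sym P (opposite x) x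
              (subst (λ c → rel P (opposite x) c ≡ true) (Fin.opposite-involutive x)
                (pairs (opposite x) (mirror-of-large (≰⇒> x≰s))))

      separates : ∀ x y → rel P (fold x) (fold y) ≡ true → fold x ≡ fold y
      separates x y = distinct-blocks⇒equal P distinct (fold-small x) (fold-small y)

  Mirrored : Point → Point → Set
  Mirrored i j = toℕ i ≡ toℕ j ⊎ toℕ i + toℕ j ≡ m

  mirror⇔ : ∀ i j → mirrorRel (suc m) i j ≡ true ⇔ Mirrored i j
  mirror⇔ i j = mk⇔
    (λ e → Sum.map (≡ᵇ⇒≡ _ _) (suc-injective ∘ ≡ᵇ⇒≡ _ _) (to Bool.T-∨ (from Bool.T-≡ e)))
    (λ mi → to Bool.T-≡ (from Bool.T-∨ (Sum.map (≡⇒≡ᵇ _ _) (≡⇒≡ᵇ _ _ ∘ cong suc) mi)))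

  mirrored-trans : ∀ i j k → Mirrored i j → Mirrored j k → Mirrored i k
  mirrored-trans i j k (inj₁ p) (inj₁ q) = inj₁ (trans p q)
  mirrored-trans i j k (inj₁ p) (inj₂ q) = inj₂ (trans (cong (_+ toℕ k) p) q)
  mirrored-trans i j k (inj₂ p) (inj₁ q) = inj₂ (trans (cong (toℕ i +_) (sym q)) p)
  mirrored-trans i j k (inj₂ p) (inj₂ q) =
    inj₁ (+-cancelʳ-≡ (toℕ j) (toℕ i) (toℕ k) (trans p (trans (sym q) (+-comm (toℕ j) (toℕ k)))))

  mirror-partition : Partition (suc m)
  mirror-partition = record
    { rel       = mirrorRel (suc m)
    ; rel-refl  = λ i → from (mirror⇔ i i) (inj₁ refl)
    ; rel-sym   = λ i j e → from (mirror⇔ j i) (Sum.map sym (trans (+-comm (toℕ j) (toℕ i))) (to (mirror⇔ i j) e))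
    ; rel-trans = λ i j k e₁ e₂ → from (mirror⇔ i k) (mirrored-trans i j k (to (mirror⇔ i j) e₁) (to (mirror⇔ j k) e₂))
    }

  -- a < b < c < d with a + c = b + d is impossible, so the mirror partition has no crossing
  mirror-non-crossing : NonCrossing mirror-partition
  mirror-non-crossing a b c d a<b b<c c<d a~c b~d with to (mirror⇔ a c) a~c | to (mirror⇔ b d) b~d
  ... | inj₁ a≡c | _ = ⊥-elim (<⇒≢ (<-trans a<b b<c) a≡c)
  ... | inj₂ _ | inj₁ b≡d = ⊥-elim (<⇒≢ (<-trans b<c c<d) b≡d)
  ... | inj₂ a+c≡m | inj₂ b+d≡m = ⊥-elim (<⇒≢ (+-mono-< a<b c<d) (trans a+c≡m (sym b+d≡m)))

  mirrorNC : NCPartition (suc m)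
  mirrorNC = record { part = mirror-partition ; nonCrossing = mirror-non-crossing }

  mirror-paired : Paired mirror-partition
  mirror-paired i _ = from (mirror⇔ i (opposite i)) (inj₂ (trans (cong (toℕ i +_) (toℕ-opposite i)) (m+[n∸m]≡n (toℕ≤m i))))

  -- i < K is not its own mirror image, since i + i < s + K = m
  mirror-no-singleton : NoSingletonAmongFirst K mirror-partition
  mirror-no-singleton i i<K singleton = <⇒≢ i+i<m (begin
      toℕ i + toℕ i               ≡⟨ cong (_+ toℕ i) (sym (cong toℕ (singleton (opposite i) (mirror-paired i i<K)))) ⟩
      toℕ (opposite i) + toℕ i    ≡⟨ cong (_+ toℕ i) (toℕ-opposite i) ⟩
      (m ∸ toℕ i) + toℕ i         ≡⟨ m∸n+n≡m (toℕ≤m i) ⟩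
      m                           ∎)
    where
      open ≡-Reasoning
      i+i<m : toℕ i + toℕ i < m
      i+i<m = subst (toℕ i + toℕ i <_) s+K≡m (+-mono-≤-< (s≤s⁻¹ (≤-trans i<K K≤1+s)) i<K)

  -- two points x, y ≤ s with x + y = m = s + K ≥ s + s must both equal s
  sum-of-small : ∀ {x y} → x ≤ s → y ≤ s → x + y ≡ m → x ≡ s
  sum-of-small {x} x≤s y≤s x+y≡m with x <? s
  ... | no x≮s = ≤-antisym x≤s (≮⇒≥ x≮s)
  ... | yes x<s = ⊥-elim (<⇒≱ (+-mono-<-≤ x<s y≤s)
          (subst (s + s ≤_) (sym x+y≡m) (subst (s + s ≤_) s+K≡m (+-monoʳ-≤ s s≤K))))

  mirror-distinct : DistinctBlocksFirst (suc s) mirror-partition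
  mirror-distinct i j i<1+s j<1+s i≢j = Bool.¬-not λ i~j → i≢j (Fin.toℕ-injective (equal (to (mirror⇔ i j) i~j)))
    where
      equal : Mirrored i j → toℕ i ≡ toℕ j
      equal (inj₁ i≡j) = i≡j
      equal (inj₂ i+j≡m) = trans (sum-of-small (s≤s⁻¹ i<1+s) (s≤s⁻¹ j<1+s) i+j≡m)
        (sym (sum-of-small (s≤s⁻¹ j<1+s) (s≤s⁻¹ i<1+s) (trans (+-comm (toℕ j) (toℕ i)) i+j≡m)))

  mirror-shaped : Shaped s K mirror-partition
  mirror-shaped = mirror-no-singleton , mirror-distinct

  shaped⇒mirror : (π : NCPartition (suc m)) → Shaped s K (part π) →
    ∀ i j → rel (part π) i j ≡ mirrorRel (suc m) i j
  shaped⇒mirror π shaped = same-transversal⇒same-blocks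
    (fold-transversal (part π) (proj₂ shaped) (paired π shaped))
    (fold-transversal mirror-partition mirror-distinct mirror-paired)

lemma5p9 : (m : ℕ) →
  (Σ (NCPartition (suc m)) λ π → InW (suc m) m π
      × (∀ (i j : Fin (suc m)) → rel (part π) i j ≡ mirrorRel (suc m) i j))
  × (∀ (π : NCPartition (suc m)) → InW (suc m) m π →
      ∀ (i j : Fin (suc m)) → rel (part π) i j ≡ mirrorRel (suc m) i j)
lemma5p9 m =
    (mirrorNC , from (InW⇔Shaped m mirrorNC) mirror-shaped , λ _ _ → refl)
  , λ π π∈W → shaped⇒mirror π (to (InW⇔Shaped m π) π∈W)
  where open WPartitions (halves m)
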